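{- Let $G$ be a connected trigraph with two red stumps. Then $\textnormal{tww}(G)\geq 2$.
   Context: A trigraph has edges partitioned into black and red edges. A vertex $u$ has a red stump $vw$ if $uv$ is a black edge, $vw$ is a red edge, $v$ has degree $2$ and $w$ has degree $1$. Contracting two distinct vertices $u,v$ replaces them by a new vertex joined by a black edge to each vertex joined to both by black edges and by a red edge to every other vertex adjacent to $u$ or $v$. A contraction sequence contracts repeatedly until one vertex remains; its width is the maximum red degree appearing; $\textnormal{tww}(G)$ is the minimum width of a contraction sequence of $G$. -}

module Defs where

open import Data.Nat using (ℕ; zero; suc; _+_; _⊔_; _≤_)
open import Data.Fin using (Fin; _≟_; punchIn)
open import Data.List using (List; map; foldr; allFin)
open import Data.Nat.ListAction using (sum)
open import Data.Product using (_×_; Σ; ∃-syntax)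
open import Data.Bool using (if_then_else_)
open import Relation.Nullary using (¬_; does)
open import Relation.Binary.PropositionalEquality using (_≡_; _≢_)

data Edge : Set where
  none black red : Edge

Adj : ℕ → Set
Adj n = Fin n → Fin n → Edge

IsTrigraph : {n : ℕ} → Adj n → Set
IsTrigraph {n} E = ((x y : Fin n) → E x y ≡ E y x) × ((x : Fin n) → E x x ≡ none)

isRed : Edge → ℕ
isRed red = 1
isRed _   = 0

isEdge : Edge → ℕ
isEdge none = 0
isEdge _    = 1

deg : {n : ℕ} → Adj n → Fin n → ℕ
deg {n} E x = sum (map (λ y → isEdge (E x y)) (allFin n))

redDeg : {n : ℕ} → Adj n → Fin n → ℕ
redDeg {n} E x = sum (map (λ y → isRed (E x y)) (allFin n))

maxRedDeg : {n : ℕ} → Adj n → ℕ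
maxRedDeg {n} E = foldr _⊔_ 0 (map (redDeg E) (allFin n))

Adjacent : {n : ℕ} → Adj n → Fin n → Fin n → Set
Adjacent E x y = E x y ≢ none

data Reach {n : ℕ} (E : Adj n) (x : Fin n) : Fin n → Set where
  here : Reach E x x
  there : {y z : Fin n} → Reach E x y → Adjacent E y z → Reach E x z

Connected : {n : ℕ} → Adj n → Set
Connected {n} E = (x y : Fin n) → Reach E x y

HasRedStump : {n : ℕ} → Adj n → Fin n → Fin n → Fin n → Set
HasRedStump E u v w = E u v ≡ black × E v w ≡ red × deg E v ≡ 2 × deg E w ≡ 1

HasTwoRedStumps : {n : ℕ} → Adj n → Set
HasTwoRedStumps {n} E =
  ∃[ u₁ ] ∃[ v₁ ] ∃[ w₁ ] ∃[ u₂ ] ∃[ v₂ ] ∃[ w₂ ]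
    (HasRedStump E u₁ v₁ w₁ × HasRedStump E u₂ v₂ w₂ × ¬ (v₁ ≡ v₂ × w₁ ≡ w₂))

merge : Edge → Edge → Edge
merge black black = black
merge none  none  = none
merge _     _     = red

-- Contract u and v of a trigraph on Fin (suc n): vertex v is removed (remaining
-- vertices are renumbered via punchIn v), and vertex u becomes the new vertex.
contract : {n : ℕ} → Adj (suc n) → Fin (suc n) → Fin (suc n) → Adj n
contract E u v y z =
  if does (y ≟ z) then none
  else if does (punchIn v y ≟ u) then merge (E u (punchIn v z)) (E v (punchIn v z))
  else if does (punchIn v z ≟ u) then merge (E (punchIn v y) u) (E (punchIn v y) v)
  else E (punchIn v y) (punchIn v z)

data ContractionSequence : (n : ℕ) → Adj (suc n) → Set where
  done : (E : Adj 1) → ContractionSequence 0 E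
  step : {n : ℕ} (E : Adj (suc (suc n))) (u v : Fin (suc (suc n))) → u ≢ v →
         ContractionSequence n (contract E u v) → ContractionSequence (suc n) E

width : {n : ℕ} {E : Adj (suc n)} → ContractionSequence n E → ℕ
width (done E) = maxRedDeg E
width (step E u v _ s) = maxRedDeg E ⊔ width s

-- tww(G) ≥ k  ⟺  every contraction sequence of G has width ≥ k
-- (tww is the minimum width over all contraction sequences)
twwAtLeast : {n : ℕ} → Adj (suc n) → ℕ → Set
twwAtLeast {n} E k = (s : ContractionSequence n E) → k ≤ width s

-- As long as all red degrees stay ≤ 1, contractions preserve the following configuration:
-- two red pendant edges w₁v₁, w₂v₂ (each wᵢ a leaf) with v₁ ≠ v₂, w₁ ≠ v₂ and v₁, v₂ in one
-- component. Contracting two vertices off the leaves keeps both pendants, unless their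
-- anchors merge into a vertex of red degree 2. Contracting a leaf w₁ with some vertex o
-- yields a vertex whose edges are all red (w₁ only had the red edge, and merging with a
-- non-neighbour makes edges red); having at least one neighbour (by connectivity), it
-- either has red degree 2 or is a new red pendant whose anchor still reaches v₂. Since the
-- configuration needs two vertices, some trigraph of the sequence has red degree ≥ 2.
module Submission where

open import Defs
open import Data.Nat using (ℕ; suc; _+_; _⊔_; _≤_)
open import Data.Nat.Properties
  using (≤-refl; ≤-trans; ≤-reflexive; 1+n≰n; m≤m+n; m≤m⊔n; m≤n⇒m≤o+n; m≤n⇒m≤n⊔o; m≤n⇒m≤o⊔n; +-monoʳ-≤; +-comm)
open import Data.Fin using (Fin; zero; punchIn; punchOut; _≟_)
open import Data.Fin.Properties using (punchIn-punchOut; punchInᵢ≢i; punchIn-injective; any?)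
open import Data.List using (_∷_; map; foldr)
open import Data.List.Properties using (foldr-preservesᵒ)
open import Data.List.Relation.Unary.Any as Any using (here; there)
open import Data.List.Membership.Propositional using (_∈_)
open import Data.List.Membership.Propositional.Properties using (∈-allFin; ∈-map⁺)
open import Data.Nat.ListAction using (sum)
open import Data.Product using (_×_; ∃; _,_; proj₁; proj₂)
open import Data.Sum using (_⊎_; inj₁; inj₂; [_,_])
open import Function using (_∘_)
open import Relation.Nullary using (¬_; Dec; yes; no; contradiction)
open import Relation.Nullary.Decidable using (dec-true; dec-false; _×-dec_; _⊎-dec_; ¬?)
open import Relation.Binary.PropositionalEquality
  using (_≡_; _≢_; refl; sym; trans; cong; cong₂; subst; ≢-sym)

∈⇒≤-sum : ∀ {A : Set} (f : A → ℕ) {x xs} → x ∈ xs → f x ≤ sum (map f xs)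
∈⇒≤-sum f (here refl) = m≤m+n _ _
∈⇒≤-sum f {xs = y ∷ _} (there x∈xs) = m≤n⇒m≤o+n (f y) (∈⇒≤-sum f x∈xs)

∈⇒+-≤-sum : ∀ {A : Set} (f : A → ℕ) {x y xs} → x ∈ xs → y ∈ xs → x ≢ y →
            f x + f y ≤ sum (map f xs)
∈⇒+-≤-sum f (here refl) (here refl) x≢y = contradiction refl x≢y
∈⇒+-≤-sum f (here refl) (there y∈xs) _ = +-monoʳ-≤ (f _) (∈⇒≤-sum f y∈xs)
∈⇒+-≤-sum f {x} {y} {xs = _ ∷ ys} (there x∈xs) (here refl) _ =
  subst (_≤ f y + sum (map f ys)) (+-comm (f y) (f x)) (+-monoʳ-≤ (f y) (∈⇒≤-sum f x∈xs))
∈⇒+-≤-sum f {xs = z ∷ _} (there x∈xs) (there y∈xs) x≢y =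
  m≤n⇒m≤o+n (f z) (∈⇒+-≤-sum f x∈xs y∈xs x≢y)

∈⇒≤-foldr-⊔ : ∀ {x xs} → x ∈ xs → x ≤ foldr _⊔_ 0 xs
∈⇒≤-foldr-⊔ {x} {xs} x∈xs =
  foldr-preservesᵒ {P = x ≤_} (λ a b → [ m≤n⇒m≤n⊔o b , m≤n⇒m≤o⊔n a ]) 0 xs
    (inj₂ (Any.map ≤-reflexive x∈xs))

redDeg≤maxRedDeg : ∀ {n} (E : Adj n) c → redDeg E c ≤ maxRedDeg E
redDeg≤maxRedDeg E c = ∈⇒≤-foldr-⊔ (∈-map⁺ (redDeg E) (∈-allFin c))

twoRedEdges⇒2≤maxRedDeg : ∀ {n} (E : Adj n) {c d₁ d₂} → d₁ ≢ d₂ →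
                          E c d₁ ≡ red → E c d₂ ≡ red → 2 ≤ maxRedDeg E
twoRedEdges⇒2≤maxRedDeg E {c} {d₁} {d₂} d₁≢d₂ r₁ r₂ = ≤-trans 2≤redDeg (redDeg≤maxRedDeg E c)
  where
  2≤redDeg : 2 ≤ redDeg E c
  2≤redDeg = subst (_≤ redDeg E c) (cong₂ _+_ (cong isRed r₁) (cong isRed r₂))
    (∈⇒+-≤-sum (isRed ∘ E c) (∈-allFin d₁) (∈-allFin d₂) d₁≢d₂)

none? : (e : Edge) → Dec (e ≡ none)
none? none  = yes refl
none? black = no λ ()
none? red   = no λ ()

isEdge-≢none : ∀ {e} → e ≢ none → isEdge e ≡ 1
isEdge-≢none {none}  e≢none = contradiction refl e≢none
isEdge-≢none {black} _ = refl
isEdge-≢none {red}   _ = refl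

deg≡1⇒uniqueNeighbour : ∀ {n} (E : Adj n) {w v} → deg E w ≡ 1 → Adjacent E w v →
                        ∀ s → s ≢ v → E w s ≡ none
deg≡1⇒uniqueNeighbour E {w} {v} deg≡1 w~v s s≢v with none? (E w s)
... | yes ws≡none = ws≡none
... | no ws≢none = contradiction (subst (2 ≤_) deg≡1 2≤deg) (1+n≰n {1})
  where
  2≤deg : 2 ≤ deg E w
  2≤deg = subst (_≤ deg E w) (cong₂ _+_ (isEdge-≢none w~v) (isEdge-≢none ws≢none))
    (∈⇒+-≤-sum (isEdge ∘ E w) (∈-allFin v) (∈-allFin s) (≢-sym s≢v))

nonBlack-edge≡red : ∀ {e} → e ≢ black → e ≢ none → e ≡ red
nonBlack-edge≡red {none}  _ e≢none = contradiction refl e≢none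
nonBlack-edge≡red {black} e≢black _ = contradiction refl e≢black
nonBlack-edge≡red {red}   _ _ = refl

merge-none⁻¹ : ∀ {a b} → merge a b ≡ none → a ≡ none × b ≡ none
merge-none⁻¹ {none}  {none}  _ = refl , refl
merge-none⁻¹ {none}  {black} ()
merge-none⁻¹ {none}  {red}   ()
merge-none⁻¹ {black} {none}  ()
merge-none⁻¹ {black} {black} ()
merge-none⁻¹ {black} {red}   ()
merge-none⁻¹ {red}           ()

merge-black⁻¹ : ∀ {a b} → merge a b ≡ black → a ≡ black × b ≡ black
merge-black⁻¹ {black} {black} _ = refl , refl
merge-black⁻¹ {black} {none}  ()
merge-black⁻¹ {black} {red}   ()
merge-black⁻¹ {none}  {none}  ()
merge-black⁻¹ {none}  {black} ()
merge-black⁻¹ {none}  {red}   ()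
merge-black⁻¹ {red}           ()

merge-redʳ : ∀ a → merge a red ≡ red
merge-redʳ none  = refl
merge-redʳ black = refl
merge-redʳ red   = refl

red⇒Adjacent : ∀ {n} {E : Adj n} {a b} → E a b ≡ red → Adjacent E a b
red⇒Adjacent r eq with trans (sym r) eq
... | ()

Adjacent-sym : ∀ {n} {E : Adj n} → IsTrigraph E → ∀ {a b} → Adjacent E a b → Adjacent E b a
Adjacent-sym (E-sym , _) {a} {b} adj eq = adj (trans (E-sym a b) eq)

Reach-cons : ∀ {n} {E : Adj n} {a b c} → Adjacent E a b → Reach E b c → Reach E a c
Reach-cons adj here = there here adj
Reach-cons adj (there r adj′) = there (Reach-cons adj r) adj′

Reach-sym : ∀ {n} {E : Adj n} → IsTrigraph E → ∀ {a b} → Reach E a b → Reach E b a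
Reach-sym T here = here
Reach-sym T (there r adj) = Reach-cons (Adjacent-sym T adj) (Reach-sym T r)

Reach⇒neighbour : ∀ {n} {E : Adj n} → IsTrigraph E → ∀ {a b} → Reach E a b → a ≢ b →
                  ∃ λ t → Adjacent E b t
Reach⇒neighbour T here a≢a = contradiction refl a≢a
Reach⇒neighbour T (there {y} r adj) _ = y , Adjacent-sym T adj

record RedPendant {n} (E : Adj n) (w v : Fin n) : Set where
  field
    red-edge      : E w v ≡ red
    no-other-edge : ∀ s → s ≢ v → E w s ≡ none

open RedPendant

module _ {n} {E : Adj n} where

  redPendant-neighbour : ∀ {w v s} → RedPendant E w v → Adjacent E w s → s ≡ v
  redPendant-neighbour {v = v} {s} p adj with s ≟ v
  ... | yes s≡v = s≡v
  ... | no s≢v = contradiction (no-other-edge p s s≢v) adj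

  redPendant-nonBlack : ∀ {w v} → RedPendant E w v → ∀ s → E w s ≢ black
  redPendant-nonBlack {v = v} p s ws≡black with s ≟ v
  ... | yes refl with trans (sym (red-edge p)) ws≡black
  ...   | ()
  redPendant-nonBlack {v = v} p s ws≡black | no s≢v with trans (sym (no-other-edge p s s≢v)) ws≡black
  ...   | ()

  redPendants-≢ : ∀ {w₁ v₁ w₂ v₂} → RedPendant E w₁ v₁ → RedPendant E w₂ v₂ →
                  v₁ ≢ v₂ → w₁ ≢ w₂
  redPendants-≢ p₁ p₂ v₁≢v₂ refl =
    v₁≢v₂ (sym (redPendant-neighbour p₁ (red⇒Adjacent {E = E} (red-edge p₂))))

module _ {n} {E : Adj n} (T : IsTrigraph E) where

  private
    E-sym : ∀ a b → E a b ≡ E b a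
    E-sym = proj₁ T

  redPendant-≢ : ∀ {w v} → RedPendant E w v → w ≢ v
  redPendant-≢ {w} p refl with trans (sym (proj₂ T w)) (red-edge p)
  ... | ()

  redPendants-crossed : ∀ {w₁ v₁ w₂ v₂} → RedPendant E w₁ v₁ → RedPendant E w₂ v₂ →
                        w₁ ≢ v₂ → w₂ ≢ v₁
  redPendants-crossed p₁ p₂ w₁≢v₂ refl =
    w₁≢v₂ (redPendant-neighbour p₂ (Adjacent-sym T (red⇒Adjacent {E = E} (red-edge p₁))))

  redPendants-sameAnchor : ∀ {w₁ w₂ v} → RedPendant E w₁ v → RedPendant E w₂ v →
                           w₁ ≢ w₂ → 2 ≤ maxRedDeg E
  redPendants-sameAnchor {w₁} {w₂} {v} p₁ p₂ w₁≢w₂ = twoRedEdges⇒2≤maxRedDeg E w₁≢w₂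
    (trans (E-sym v w₁) (red-edge p₁)) (trans (E-sym v w₂) (red-edge p₂))

  redPendant-reach : ∀ {z t c} → RedPendant E z t → c ≢ z → Reach E c z → Reach E c t
  redPendant-reach p c≢z here = contradiction refl c≢z
  redPendant-reach {z} {t} p _ (there {y} r adj) with y ≟ t
  ... | yes refl = r
  ... | no y≢t = contradiction (trans (E-sym y z) (no-other-edge p y y≢t)) adj

module _ {n} (E : Adj n) (z : Fin n) (nonBlack : ∀ s → E z s ≢ black) where

  nonBlack-twoNeighbours : ∀ {a b} → a ≢ b → Adjacent E z a → Adjacent E z b → 2 ≤ maxRedDeg E
  nonBlack-twoNeighbours {a} {b} a≢b za zb = twoRedEdges⇒2≤maxRedDeg E a≢b
    (nonBlack-edge≡red (nonBlack a) za) (nonBlack-edge≡red (nonBlack b) zb)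

  nonBlack-neighbour : ∀ {t} → Adjacent E z t → 2 ≤ maxRedDeg E ⊎ RedPendant E z t
  nonBlack-neighbour {t} zt with any? (λ s → ¬? (s ≟ t) ×-dec ¬? (none? (E z s)))
  ... | yes (s , s≢t , zs) = inj₁ (nonBlack-twoNeighbours s≢t zs zt)
  ... | no noOther = inj₂ record
    { red-edge = nonBlack-edge≡red (nonBlack t) zt ; no-other-edge = onlyNeighbour }
    where
    onlyNeighbour : ∀ s → s ≢ t → E z s ≡ none
    onlyNeighbour s s≢t with none? (E z s)
    ... | yes zs≡none = zs≡none
    ... | no zs≢none = contradiction (s , s≢t , zs≢none) noOther

record TwoRedPendants {n} (E : Adj n) : Set where
  field
    {w₁ v₁ w₂ v₂} : Fin n
    pendant₁ : RedPendant E w₁ v₁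
    pendant₂ : RedPendant E w₂ v₂
    v₁≢v₂    : v₁ ≢ v₂
    w₁≢v₂    : w₁ ≢ v₂  -- rules out one red edge seen as a pendant from both ends
    reach    : Reach E v₁ v₂

TwoRedPendants-swap : ∀ {n} {E : Adj n} → IsTrigraph E → TwoRedPendants E → TwoRedPendants E
TwoRedPendants-swap T q = record
  { pendant₁ = pendant₂
  ; pendant₂ = pendant₁
  ; v₁≢v₂    = ≢-sym v₁≢v₂
  ; w₁≢v₂    = redPendants-crossed T pendant₁ pendant₂ w₁≢v₂
  ; reach    = Reach-sym T reach
  }
  where open TwoRedPendants q

ForcesWidthTwo : ∀ {n} → Adj n → Set
ForcesWidthTwo E = 2 ≤ maxRedDeg E ⊎ TwoRedPendants E

module Contraction {n} (E : Adj (suc (suc n))) (T : IsTrigraph E)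
                   {x y : Fin (suc (suc n))} (x≢y : x ≢ y) where

  private
    E-sym : ∀ a b → E a b ≡ E b a
    E-sym = proj₁ T

  E′ : Adj (suc n)
  E′ = contract E x y

  Merged : Fin (suc (suc n)) → Set
  Merged a = a ≡ x ⊎ a ≡ y

  merged? : ∀ a → Dec (Merged a)
  merged? a = (a ≟ x) ⊎-dec (a ≟ y)

  unmerged-≢ : ∀ {a b c} → Merged a → Merged b → a ≢ b → c ≢ a → c ≢ b → ¬ Merged c
  unmerged-≢ (inj₁ refl) (inj₁ refl) a≢b = contradiction refl a≢b
  unmerged-≢ (inj₁ refl) (inj₂ refl) _ c≢x c≢y = [ c≢x , c≢y ]
  unmerged-≢ (inj₂ refl) (inj₁ refl) _ c≢y c≢x = [ c≢x , c≢y ]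
  unmerged-≢ (inj₂ refl) (inj₂ refl) a≢b = contradiction refl a≢b

  -- The vertex map of the contraction: y goes where x goes, and punchIn y is a section.
  π : Fin (suc (suc n)) → Fin (suc n)
  π a with a ≟ y
  ... | yes _   = punchOut (x≢y ∘ sym)
  ... | no a≢y = punchOut (a≢y ∘ sym)

  punchIn-π-≢y : ∀ {a} → a ≢ y → punchIn y (π a) ≡ a
  punchIn-π-≢y {a} a≢y with a ≟ y
  ... | yes a≡y  = contradiction a≡y a≢y
  ... | no a≢y′ = punchIn-punchOut (a≢y′ ∘ sym)

  punchIn-π-y : punchIn y (π y) ≡ x
  punchIn-π-y with y ≟ y
  ... | yes _   = punchIn-punchOut (x≢y ∘ sym)
  ... | no y≢y = contradiction refl y≢y

  π-punchIn : ∀ s → π (punchIn y s) ≡ s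
  π-punchIn s = punchIn-injective y _ _ (punchIn-π-≢y (punchInᵢ≢i y s))

  ∀-π : ∀ {P : Fin (suc n) → Set} → (∀ a → P (π a)) → ∀ s → P s
  ∀-π {P} h s = subst P (π-punchIn s) (h (punchIn y s))

  punchIn-π-merged : ∀ {a} → Merged a → punchIn y (π a) ≡ x
  punchIn-π-merged (inj₁ refl) = punchIn-π-≢y x≢y
  punchIn-π-merged (inj₂ refl) = punchIn-π-y

  punchIn-π-unmerged : ∀ {a} → ¬ Merged a → punchIn y (π a) ≡ a
  punchIn-π-unmerged ¬ma = punchIn-π-≢y (¬ma ∘ inj₂)

  punchIn-π-unmerged-≢x : ∀ {a} → ¬ Merged a → punchIn y (π a) ≢ x
  punchIn-π-unmerged-≢x ¬ma eq = ¬ma (inj₁ (trans (sym (punchIn-π-unmerged ¬ma)) eq))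

  π-merged : ∀ {a b} → Merged a → Merged b → π a ≡ π b
  π-merged ma mb =
    punchIn-injective y _ _ (trans (punchIn-π-merged ma) (sym (punchIn-π-merged mb)))

  π-unmerged-≢ : ∀ {a b} → ¬ Merged a → a ≢ b → π a ≢ π b
  π-unmerged-≢ {a} {b} ¬ma a≢b πa≡πb with merged? b
  ... | yes mb  = punchIn-π-unmerged-≢x ¬ma (trans (cong (punchIn y) πa≡πb) (punchIn-π-merged mb))
  ... | no ¬mb = a≢b (trans (sym (punchIn-π-unmerged ¬ma))
                            (trans (cong (punchIn y) πa≡πb) (punchIn-π-unmerged ¬mb)))

  unmerged-merged-≢ : ∀ {a b} → ¬ Merged a → Merged b → a ≢ b
  unmerged-merged-≢ ¬ma mb refl = ¬ma mb

  mergedEdge : Fin (suc (suc n)) → Edge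
  mergedEdge b = merge (E x b) (E y b)

  mergedEdge-none⁻¹ : ∀ {a b} → Merged a → mergedEdge b ≡ none → E a b ≡ none
  mergedEdge-none⁻¹ (inj₁ refl) = proj₁ ∘ merge-none⁻¹
  mergedEdge-none⁻¹ (inj₂ refl) = proj₂ ∘ merge-none⁻¹

  mergedEdge-black⁻¹ : ∀ {a b} → Merged a → mergedEdge b ≡ black → E a b ≡ black
  mergedEdge-black⁻¹ (inj₁ refl) = proj₁ ∘ merge-black⁻¹
  mergedEdge-black⁻¹ (inj₂ refl) = proj₂ ∘ merge-black⁻¹

  mergedEdge-red : ∀ {a b} → Merged a → E a b ≡ red → mergedEdge b ≡ red
  mergedEdge-red (inj₁ refl) r rewrite r = refl
  mergedEdge-red {b = b} (inj₂ refl) r rewrite r = merge-redʳ (E x b)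

  contract-diagonal : ∀ s → E′ s s ≡ none
  contract-diagonal s rewrite dec-true (s ≟ s) refl = refl

  contract-merged-merged : ∀ {a b} → Merged a → Merged b → E′ (π a) (π b) ≡ none
  contract-merged-merged {a} ma mb =
    subst (λ t → E′ (π a) t ≡ none) (π-merged ma mb) (contract-diagonal (π a))

  contract-merged-unmerged : ∀ {a b} → Merged a → ¬ Merged b → E′ (π a) (π b) ≡ mergedEdge b
  contract-merged-unmerged {a} {b} ma ¬mb
    rewrite dec-false (π a ≟ π b) (≢-sym (π-unmerged-≢ ¬mb (unmerged-merged-≢ ¬mb ma)))
          | dec-true (punchIn y (π a) ≟ x) (punchIn-π-merged ma)
          | punchIn-π-unmerged ¬mb = refl

  contract-unmerged-merged : ∀ {a b} → ¬ Merged a → Merged b → E′ (π a) (π b) ≡ mergedEdge a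
  contract-unmerged-merged {a} {b} ¬ma mb
    rewrite dec-false (π a ≟ π b) (π-unmerged-≢ ¬ma (unmerged-merged-≢ ¬ma mb))
          | dec-false (punchIn y (π a) ≟ x) (punchIn-π-unmerged-≢x ¬ma)
          | dec-true (punchIn y (π b) ≟ x) (punchIn-π-merged mb)
          | punchIn-π-unmerged ¬ma = cong₂ merge (E-sym a x) (E-sym a y)

  contract-unmerged : ∀ {a b} → ¬ Merged a → ¬ Merged b → E′ (π a) (π b) ≡ E a b
  contract-unmerged {a} {b} ¬ma ¬mb with a ≟ b
  ... | yes refl = trans (contract-diagonal (π a)) (sym (proj₂ T a))
  ... | no a≢b
    rewrite dec-false (π a ≟ π b) (π-unmerged-≢ ¬ma a≢b)
          | dec-false (punchIn y (π a) ≟ x) (punchIn-π-unmerged-≢x ¬ma)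
          | dec-false (punchIn y (π b) ≟ x) (punchIn-π-unmerged-≢x ¬mb)
          | punchIn-π-unmerged ¬ma
          | punchIn-π-unmerged ¬mb = refl

  contract-sym-π : ∀ a b → E′ (π a) (π b) ≡ E′ (π b) (π a)
  contract-sym-π a b with merged? a | merged? b
  ... | yes ma | yes mb =
    trans (contract-merged-merged ma mb) (sym (contract-merged-merged mb ma))
  ... | yes ma | no ¬mb =
    trans (contract-merged-unmerged ma ¬mb) (sym (contract-unmerged-merged ¬mb ma))
  ... | no ¬ma | yes mb =
    trans (contract-unmerged-merged ¬ma mb) (sym (contract-merged-unmerged mb ¬ma))
  ... | no ¬ma | no ¬mb =
    trans (contract-unmerged ¬ma ¬mb) (trans (E-sym a b) (sym (contract-unmerged ¬mb ¬ma)))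

  contract-isTrigraph : IsTrigraph E′
  contract-isTrigraph = ∀-π (λ a → ∀-π (contract-sym-π a)) , contract-diagonal

  contract-adjacent-merged : ∀ {a b} → Merged a → ¬ Merged b → Adjacent E a b →
                             Adjacent E′ (π a) (π b)
  contract-adjacent-merged ma ¬mb adj eq =
    adj (mergedEdge-none⁻¹ ma (trans (sym (contract-merged-unmerged ma ¬mb)) eq))

  contract-adjacent : ∀ {a b} → π a ≢ π b → Adjacent E a b → Adjacent E′ (π a) (π b)
  contract-adjacent {a} {b} πa≢πb adj with merged? a | merged? b
  ... | yes ma | yes mb = contradiction (π-merged ma mb) πa≢πb
  ... | yes ma | no ¬mb = contract-adjacent-merged ma ¬mb adj
  ... | no ¬ma | yes mb = Adjacent-sym contract-isTrigraph {π b} {π a}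
                            (contract-adjacent-merged mb ¬ma (Adjacent-sym T adj))
  ... | no ¬ma | no ¬mb = λ eq → adj (trans (sym (contract-unmerged ¬ma ¬mb)) eq)

  contract-reach : ∀ {a b} → Reach E a b → Reach E′ (π a) (π b)
  contract-reach here = here
  contract-reach {a} (there {c} {d} r adj) with π c ≟ π d
  ... | yes πc≡πd = subst (Reach E′ (π a)) πc≡πd (contract-reach r)
  ... | no πc≢πd = there (contract-reach r) (contract-adjacent πc≢πd adj)

  contract-redPendant : ∀ {w v} → ¬ Merged w → RedPendant E w v → RedPendant E′ (π w) (π v)
  contract-redPendant {w} {v} ¬mw p = record { red-edge = redEdge ; no-other-edge = ∀-π noOther }
    where
    redEdge : E′ (π w) (π v) ≡ red
    redEdge with merged? v
    ... | yes mv  = trans (contract-unmerged-merged ¬mw mv)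
                          (mergedEdge-red mv (trans (E-sym v w) (red-edge p)))
    ... | no ¬mv = trans (contract-unmerged ¬mw ¬mv) (red-edge p)

    noOther : ∀ b → π b ≢ π v → E′ (π w) (π b) ≡ none
    noOther b πb≢πv with merged? b
    ... | yes mb  = trans (contract-unmerged-merged ¬mw mb)
                          (cong₂ merge (awayFrom (inj₁ refl)) (awayFrom (inj₂ refl)))
      where
      awayFrom : ∀ {c} → Merged c → E c w ≡ none
      awayFrom {c} mc = trans (E-sym c w) (no-other-edge p c
        (λ c≡v → πb≢πv (π-merged mb (subst Merged c≡v mc))))
    ... | no ¬mb = trans (contract-unmerged ¬mw ¬mb) (no-other-edge p b (πb≢πv ∘ cong π))

  contract-merged-redPendant-nonBlack : ∀ {w v} → Merged w → RedPendant E w v →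
                                        ∀ s → E′ (π w) s ≢ black
  contract-merged-redPendant-nonBlack {w} mw p = ∀-π nonBlack
    where
    nonBlack : ∀ b → E′ (π w) (π b) ≢ black
    nonBlack b eq with merged? b
    ... | yes mb with trans (sym (contract-merged-merged mw mb)) eq
    ...   | ()
    nonBlack b eq | no ¬mb = redPendant-nonBlack p b
      (mergedEdge-black⁻¹ mw (trans (sym (contract-merged-unmerged mw ¬mb)) eq))

  private
    T′ : IsTrigraph E′
    T′ = contract-isTrigraph

  module _ (q : TwoRedPendants E) where
    open TwoRedPendants q

    private
      w₁~v₁ : Adjacent E w₁ v₁
      w₁~v₁ = red⇒Adjacent {E = E} (red-edge pendant₁)

      w₂~v₂ : Adjacent E w₂ v₂
      w₂~v₂ = red⇒Adjacent {E = E} (red-edge pendant₂)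

      w₁≢w₂ : w₁ ≢ w₂
      w₁≢w₂ = redPendants-≢ pendant₁ pendant₂ v₁≢v₂

      v₁≢w₁ : v₁ ≢ w₁
      v₁≢w₁ = ≢-sym (redPendant-≢ T pendant₁)

      v₂≢w₂ : v₂ ≢ w₂
      v₂≢w₂ = ≢-sym (redPendant-≢ T pendant₂)

      v₁≢w₂ : v₁ ≢ w₂
      v₁≢w₂ = ≢-sym (redPendants-crossed T pendant₁ pendant₂ w₁≢v₂)

    unleafMergeds : ¬ Merged w₁ → ¬ Merged w₂ → ForcesWidthTwo E′
    unleafMergeds ¬m₁ ¬m₂ =
      fromPendants (contract-redPendant ¬m₁ pendant₁) (contract-redPendant ¬m₂ pendant₂)
      where
      fromPendants : RedPendant E′ (π w₁) (π v₁) → RedPendant E′ (π w₂) (π v₂) → ForcesWidthTwo E′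
      fromPendants p₁ p₂ with π v₁ ≟ π v₂
      ... | yes πv₁≡πv₂ = inj₁ (redPendants-sameAnchor T′ p₁
              (subst (RedPendant E′ (π w₂)) (sym πv₁≡πv₂) p₂) (π-unmerged-≢ ¬m₁ w₁≢w₂))
      ... | no πv₁≢πv₂ = inj₂ record
        { pendant₁ = p₁
        ; pendant₂ = p₂
        ; v₁≢v₂    = πv₁≢πv₂
        ; w₁≢v₂    = π-unmerged-≢ ¬m₁ w₁≢v₂
        ; reach    = contract-reach reach
        }

    module _ (m₁ : Merged w₁) where

      private
        nonBlack : ∀ s → E′ (π w₁) s ≢ black
        nonBlack = contract-merged-redPendant-nonBlack m₁ pendant₁

        mergedNeighbour : ∀ {a b} → Merged a → ¬ Merged b → Adjacent E a b →
                          Adjacent E′ (π w₁) (π b)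
        mergedNeighbour {b = b} ma ¬mb adj =
          subst (λ u → Adjacent E′ u (π b)) (π-merged ma m₁) (contract-adjacent-merged ma ¬mb adj)

      module _ (¬m₂ : ¬ Merged w₂) (¬n₂ : ¬ Merged v₂) where

        private
          pendant₂′ : RedPendant E′ (π w₂) (π v₂)
          pendant₂′ = contract-redPendant ¬m₂ pendant₂

          z⇝πv₂ : Reach E′ (π w₁) (π v₂)
          z⇝πv₂ = contract-reach (Reach-cons w₁~v₁ reach)

          z≢πv₂ : π w₁ ≢ π v₂
          z≢πv₂ = ≢-sym (π-unmerged-≢ ¬n₂ (≢-sym w₁≢v₂))

        -- The merged vertex has only red edges, so with a single neighbour t it is a new red
        -- pendant at t; t still reaches v₂, since every path into a pendant passes its anchor.
        leafMerged-otherUnmerged : ForcesWidthTwo E′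
        leafMerged-otherUnmerged with Reach⇒neighbour T′ (Reach-sym T′ z⇝πv₂) (≢-sym z≢πv₂)
        ... | t , z~t with nonBlack-neighbour E′ (π w₁) nonBlack z~t
        ...   | inj₁ 2≤max = inj₁ 2≤max
        ...   | inj₂ pz with t ≟ π v₂
        ...     | yes refl = inj₁ (redPendants-sameAnchor T′ pz pendant₂′
                                     (≢-sym (π-unmerged-≢ ¬m₂ (≢-sym w₁≢w₂))))
        ...     | no t≢πv₂ = inj₂ record
          { pendant₁ = pz
          ; pendant₂ = pendant₂′
          ; v₁≢v₂    = t≢πv₂
          ; w₁≢v₂    = z≢πv₂
          ; reach    = Reach-sym T′ (redPendant-reach T′ pz (≢-sym z≢πv₂) (Reach-sym T′ z⇝πv₂))
          }

      leafMerged : ForcesWidthTwo E′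
      leafMerged with merged? w₂ | merged? v₂
      ... | yes m₂ | _ = inj₁ (nonBlack-twoNeighbours E′ (π w₁) nonBlack (π-unmerged-≢ ¬mv₁ v₁≢v₂)
                               (mergedNeighbour m₁ ¬mv₁ w₁~v₁) (mergedNeighbour m₂ ¬mv₂ w₂~v₂))
        where
        ¬mv₁ = unmerged-≢ m₁ m₂ w₁≢w₂ v₁≢w₁ v₁≢w₂
        ¬mv₂ = unmerged-≢ m₁ m₂ w₁≢w₂ (≢-sym w₁≢v₂) v₂≢w₂
      ... | no ¬m₂ | yes n₂ = inj₁ (nonBlack-twoNeighbours E′ (π w₁) nonBlack (π-unmerged-≢ ¬mv₁ v₁≢w₂)
                               (mergedNeighbour m₁ ¬mv₁ w₁~v₁)
                               (mergedNeighbour n₂ ¬m₂ (Adjacent-sym T w₂~v₂)))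
        where
        ¬mv₁ = unmerged-≢ m₁ n₂ w₁≢v₂ v₁≢w₁ v₁≢v₂
      ... | no ¬m₂ | no ¬n₂ = leafMerged-otherUnmerged ¬m₂ ¬n₂

  contract-forcesWidthTwo : TwoRedPendants E → ForcesWidthTwo E′
  contract-forcesWidthTwo q with merged? (TwoRedPendants.w₁ q) | merged? (TwoRedPendants.w₂ q)
  ... | yes m₁ | _      = leafMerged q m₁
  ... | no _   | yes m₂ = leafMerged (TwoRedPendants-swap T q) m₂
  ... | no ¬m₁ | no ¬m₂ = unleafMergeds q ¬m₁ ¬m₂

maxRedDeg≤width : ∀ {n} {E : Adj (suc n)} (s : ContractionSequence n E) → maxRedDeg E ≤ width s
maxRedDeg≤width (done E)         = ≤-refl
maxRedDeg≤width (step E _ _ _ s) = m≤m⊔n _ (width s)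

¬TwoRedPendants-Fin1 : (E : Adj 1) → ¬ TwoRedPendants E
¬TwoRedPendants-Fin1 E q = TwoRedPendants.v₁≢v₂ q (Fin1-≡ _ _)
  where
  Fin1-≡ : (a b : Fin 1) → a ≡ b
  Fin1-≡ zero zero = refl

ForcesWidthTwo⇒2≤width : ∀ {n} {E : Adj (suc n)} → IsTrigraph E → ForcesWidthTwo E →
                         (s : ContractionSequence n E) → 2 ≤ width s
ForcesWidthTwo⇒2≤width T (inj₁ 2≤max) s = ≤-trans 2≤max (maxRedDeg≤width s)
ForcesWidthTwo⇒2≤width T (inj₂ q) (done E) = contradiction q (¬TwoRedPendants-Fin1 E)
ForcesWidthTwo⇒2≤width T (inj₂ q) (step E _ _ x≢y s) =
  m≤n⇒m≤o⊔n (maxRedDeg E) (ForcesWidthTwo⇒2≤width contract-isTrigraph (contract-forcesWidthTwo q) s)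
  where open Contraction E T x≢y

redStump⇒redPendant : ∀ {n} {E : Adj n} → IsTrigraph E → ∀ {u v w} → HasRedStump E u v w →
                      RedPendant E w v
redStump⇒redPendant {E = E} (E-sym , _) {v = v} {w} (_ , vw≡red , _ , deg-w≡1) = record
  { red-edge      = wv≡red
  ; no-other-edge = deg≡1⇒uniqueNeighbour E deg-w≡1 (red⇒Adjacent {E = E} wv≡red)
  }
  where
  wv≡red : E w v ≡ red
  wv≡red = trans (E-sym w v) vw≡red

twoRedStumps⇒ForcesWidthTwo : ∀ {n} {E : Adj n} → IsTrigraph E → Connected E →
                              HasTwoRedStumps E → ForcesWidthTwo E
twoRedStumps⇒ForcesWidthTwo {E = E} T conn
  (_ , v₁ , w₁ , _ , v₂ , w₂ , s₁@(_ , _ , deg-v₁≡2 , _) , s₂@(_ , v₂w₂≡red , _ , deg-w₂≡1) , distinct) =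
  fromPendants (redStump⇒redPendant T s₁) (redStump⇒redPendant T s₂)
  where
  fromPendants : RedPendant E w₁ v₁ → RedPendant E w₂ v₂ → ForcesWidthTwo E
  fromPendants p₁ p₂ with v₁ ≟ v₂ | w₁ ≟ v₂
  ... | yes refl | _ = inj₁ (redPendants-sameAnchor T p₁ p₂ (λ w₁≡w₂ → distinct (refl , w₁≡w₂)))
  -- If w₁ = v₂, then w₂ is a neighbour of the leaf w₁, so w₂ = v₁; but deg v₁ = 2 ≠ 1 = deg w₂.
  ... | no _ | yes refl with redPendant-neighbour p₁ (red⇒Adjacent {E = E} v₂w₂≡red)
  ...   | refl with trans (sym deg-v₁≡2) deg-w₂≡1
  ...     | ()
  fromPendants p₁ p₂ | no v₁≢v₂ | no w₁≢v₂ = inj₂ record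
    { pendant₁ = p₁ ; pendant₂ = p₂ ; v₁≢v₂ = v₁≢v₂ ; w₁≢v₂ = w₁≢v₂ ; reach = conn v₁ v₂ }

lemma13 : (n : ℕ) (G : Adj (suc n)) → IsTrigraph G → Connected G → HasTwoRedStumps G →
    twwAtLeast G 2
lemma13 n G T conn stumps = ForcesWidthTwo⇒2≤width T (twoRedStumps⇒ForcesWidthTwo T conn stumps)
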